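{- Let $G,H$ be finite abelian groups, $k\ge1$, and $f:G\to H$ any function. Then \[\sum_{\varphi\in\mathrm{Hom}(G,H)}\mathrm{agr}(f,\varphi)^k=\eta_k\cdot\mathbb{E}_{\vec x\sim\mathcal{G}_k}\bigl[\mathbf{1}\{f(\vec x)\in\mathsf{H}_{\vec x}\}\,|\ker\Gamma_{\vec x}|\bigr]+(1-\eta_k)\frac{|\mathrm{Hom}(G,H)|}{|H|^k},\] where $\vec x\sim\mathcal{G}_k$ is uniform and $f(\vec x)=(f(x_1),\dots,f(x_k))$.
   Context: $\mathrm{agr}(f,\varphi)=\Pr_{x\sim G}[f(x)=\varphi(x)]$, $x$ uniform. $\mathrm{Hom}(G,H)$ is an abelian group under pointwise operation. For $\vec x=(x_1,\dots,x_k)\in G^k$, $\Gamma_{\vec x}:\mathrm{Hom}(G,H)\to H^k$, $\varphi\mapsto(\varphi(x_1),\dots,\varphi(x_k))$ (a homomorphism), $\mathsf{H}_{\vec x}$ its image, $\mathcal{G}_k=\{\vec x\in G^k:\mathsf{H}_{\vec x}\ne H^k\}$ and $\eta_k=|\mathcal{G}_k|/|G|^k$. -}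

module Defs where

open import Data.Nat as ℕ using (ℕ; zero; suc)
open import Data.Integer using (+_)
open import Data.Rational as ℚ using (ℚ; 0ℚ; 1ℚ; _/_)
open import Data.Fin using (Fin)
import Data.Fin.Properties as FinP
open import Data.Vec as Vec using (Vec; []; _∷_; lookup; replicate)
open import Data.Vec.Properties using (≡-dec)
open import Data.List as List using (List; []; _∷_; allFin; filter; length; concatMap; foldr)
open import Data.List.Relation.Unary.All using (All; all?)
open import Data.List.Relation.Unary.Any using (Any; any?)
open import Function.Bundles using (Inverse; _↔_)
open import Relation.Binary.PropositionalEquality using (_≡_; cong; sym; trans)
open import Relation.Binary.Definitions using (DecidableEquality)
open import Relation.Nullary using (Dec; yes; no; ¬_)
open import Relation.Nullary.Decidable using (¬?)
import Algebra.Structures as AS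

record FinAbGroup : Set₁ where
  field
    Carrier        : Set
    _∙_            : Carrier → Carrier → Carrier
    ε              : Carrier
    _⁻¹            : Carrier → Carrier
    isAbelianGroup : AS.IsAbelianGroup (_≡_ {A = Carrier}) _∙_ ε _⁻¹
    size           : ℕ
    enum           : Fin size ↔ Carrier

  elements : List Carrier
  elements = List.map (Inverse.to enum) (allFin size)

  _≟_ : DecidableEquality Carrier
  x ≟ y with FinP._≟_ (Inverse.from enum x) (Inverse.from enum y)
  ... | yes p = yes (trans (sym (Inverse.strictlyInverseˡ enum x))
                       (trans (cong (Inverse.to enum) p) (Inverse.strictlyInverseˡ enum y)))
  ... | no ¬p = no (λ x≡y → ¬p (cong (Inverse.from enum) x≡y))

allVecs : ∀ {A : Set} → List A → (k : ℕ) → List (Vec A k)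
allVecs xs zero    = [] ∷ []
allVecs xs (suc k) = concatMap (λ a → List.map (a ∷_) (allVecs xs k)) xs

-- m / n as a rational; only ever used with n ≠ 0 (guard gives 0 otherwise)
_/ₙ_ : ℕ → ℕ → ℚ
m /ₙ zero  = 0ℚ
m /ₙ suc n = (+ m) / suc n

_^ℚ_ : ℚ → ℕ → ℚ
p ^ℚ zero  = 1ℚ
p ^ℚ suc n = p ℚ.* (p ^ℚ n)

sumℚ : List ℚ → ℚ
sumℚ = foldr ℚ._+_ 0ℚ

sumℕ : List ℕ → ℕ
sumℕ = foldr ℕ._+_ 0

module _ (G H : FinAbGroup) where
  private
    module G = FinAbGroup G
    module H = FinAbGroup H

  -- φ : G → H is a homomorphism: φ(x+y) = φ(x)+φ(y) for all x, y ∈ G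
  -- (checked over the complete list of elements of G, hence decidable)
  IsHom : (G.Carrier → H.Carrier) → Set
  IsHom φ = All (λ x → All (λ y → φ (x G.∙ y) ≡ φ x H.∙ φ y) G.elements) G.elements

  isHom? : (φ : G.Carrier → H.Carrier) → Dec (IsHom φ)
  isHom? φ = all? (λ x → all? (λ y → φ (x G.∙ y) H.≟ (φ x H.∙ φ y)) G.elements) G.elements

  allFunctions : List (G.Carrier → H.Carrier)
  allFunctions = List.map (λ v x → lookup v (Inverse.from G.enum x)) (allVecs H.elements G.size)

  Hom : List (G.Carrier → H.Carrier)
  Hom = filter isHom? allFunctions

  agr : (G.Carrier → H.Carrier) → (G.Carrier → H.Carrier) → ℚ
  agr f φ = length (filter (λ x → f x H.≟ φ x) G.elements) /ₙ G.size

  Γ : ∀ {k} → Vec G.Carrier k → (G.Carrier → H.Carrier) → Vec H.Carrier k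
  Γ xs φ = Vec.map φ xs

  InImage : ∀ {k} → Vec G.Carrier k → Vec H.Carrier k → Set
  InImage xs h = Any (λ φ → Γ xs φ ≡ h) Hom

  inImage? : ∀ {k} (xs : Vec G.Carrier k) (h : Vec H.Carrier k) → Dec (InImage xs h)
  inImage? xs h = any? (λ φ → ≡-dec H._≟_ (Γ xs φ) h) Hom

  InGk : ∀ {k} → Vec G.Carrier k → Set
  InGk {k} xs = ¬ All (InImage xs) (allVecs H.elements k)

  inGk? : ∀ {k} (xs : Vec G.Carrier k) → Dec (InGk xs)
  inGk? {k} xs = ¬? (all? (inImage? xs) (allVecs H.elements k))

  𝒢 : (k : ℕ) → List (Vec G.Carrier k)
  𝒢 k = filter inGk? (allVecs G.elements k)

  η : ℕ → ℚ
  η k = length (𝒢 k) /ₙ (G.size ℕ.^ k)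

  kerSize : ∀ {k} → Vec G.Carrier k → ℕ
  kerSize {k} xs = length (filter (λ φ → ≡-dec H._≟_ (Γ xs φ) (replicate k H.ε)) Hom)

  term : ∀ {k} → (G.Carrier → H.Carrier) → Vec G.Carrier k → ℕ
  term f xs with inImage? xs (Vec.map f xs)
  ... | yes _ = kerSize xs
  ... | no  _ = 0

  -- E_{x ∼ 𝒢_k}[ 1{f(x) ∈ 𝖧_x} |ker Γ_x| ]  (uniform on 𝒢_k; 0 if 𝒢_k = ∅)
  expect : (k : ℕ) → (G.Carrier → H.Carrier) → ℚ
  expect k f = sumℕ (List.map (term f) (𝒢 k)) /ₙ length (𝒢 k)

module Submission where

-- Expanding agr(f,φ)ᵏ counts the k-tuples x with Γ_x(φ) = f(x), so the left-hand side is
-- |G|⁻ᵏ Σ_x |Γ_x⁻¹(f(x))|.  A nonempty fibre of the homomorphism Γ_x is a coset of ker Γ_x, so the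
-- summand is 1{f(x) ∈ 𝖧_x}·|ker Γ_x|; for x ∉ 𝒢ₖ the map Γ_x is onto, its |H|ᵏ fibres partition
-- Hom(G,H), and the summand is |Hom(G,H)|/|H|ᵏ.  Splitting the sum along 𝒢ₖ gives the two terms.

open import Defs

module FiniteSums where
  open import Data.Nat using (ℕ; suc; _+_; _*_)
  import Data.Nat.Properties as ℕ
  open import Data.Nat.Tactic.RingSolver using (solve-∀)
  open import Data.List using (List; []; _∷_; map; length; filter; concatMap; _++_)
  open import Data.List.Relation.Unary.All using (All; []; _∷_)
  open import Data.List.Relation.Unary.Any using (Any; here; there)
  open import Data.Empty using (⊥-elim)
  open import Function.Base using (_∘_)
  open import Function.Bundles using (_⇔_; mk⇔; Equivalence)
  open import Relation.Nullary using (Dec; yes; no; ¬_)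
  open import Relation.Nullary.Decidable using (¬?)
  open import Relation.Unary using (Decidable)
  open import Relation.Binary.PropositionalEquality

  private variable
    A B P Q : Set

  ∑ : List A → (A → ℕ) → ℕ
  ∑ L g = sumℕ (map g L)

  syntax ∑ L (λ x → e) = ∑[ x ← L ] e

  𝟙 : Dec P → ℕ
  𝟙 (yes _) = 1
  𝟙 (no _)  = 0

  𝟙-cong : P ⇔ Q → (p : Dec P) (q : Dec Q) → 𝟙 p ≡ 𝟙 q
  𝟙-cong _   (yes _) (yes _) = refl
  𝟙-cong P⇔Q (yes p) (no ¬q) = ⊥-elim (¬q (Equivalence.to P⇔Q p))
  𝟙-cong P⇔Q (no ¬p) (yes q) = ⊥-elim (¬p (Equivalence.from P⇔Q q))
  𝟙-cong _   (no _)  (no _)  = refl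

  𝟙-sym : {a b : A} (p : Dec (a ≡ b)) (q : Dec (b ≡ a)) → 𝟙 p ≡ 𝟙 q
  𝟙-sym = 𝟙-cong (mk⇔ sym sym)

  ∑-cong : (L : List A) {g h : A → ℕ} → (∀ a → g a ≡ h a) → ∑ L g ≡ ∑ L h
  ∑-cong []      g≗h = refl
  ∑-cong (a ∷ L) g≗h = cong₂ _+_ (g≗h a) (∑-cong L g≗h)

  ∑-zero : (L : List A) {g : A → ℕ} → (∀ a → g a ≡ 0) → ∑ L g ≡ 0
  ∑-zero []      g≗0 = refl
  ∑-zero (a ∷ L) g≗0 rewrite g≗0 a = ∑-zero L g≗0

  ∑-+ : (L : List A) (g h : A → ℕ) → ∑[ a ← L ] (g a + h a) ≡ ∑ L g + ∑ L h
  ∑-+ []      g h = refl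
  ∑-+ (a ∷ L) g h rewrite ∑-+ L g h = interchange (g a) (h a) (∑ L g) (∑ L h)
    where
    interchange : ∀ w x y z → (w + x) + (y + z) ≡ (w + y) + (x + z)
    interchange = solve-∀

  ∑-*ˡ : (L : List A) (c : ℕ) (g : A → ℕ) → ∑[ a ← L ] (c * g a) ≡ c * ∑ L g
  ∑-*ˡ []      c g = sym (ℕ.*-zeroʳ c)
  ∑-*ˡ (a ∷ L) c g rewrite ∑-*ˡ L c g = sym (ℕ.*-distribˡ-+ c (g a) (∑ L g))

  ∑-*ʳ : (L : List A) (c : ℕ) (g : A → ℕ) → ∑[ a ← L ] (g a * c) ≡ ∑ L g * c
  ∑-*ʳ []      c g = refl
  ∑-*ʳ (a ∷ L) c g rewrite ∑-*ʳ L c g = sym (ℕ.*-distribʳ-+ c (g a) (∑ L g))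

  ∑-const : (L : List A) (c : ℕ) → ∑[ _ ← L ] c ≡ length L * c
  ∑-const []      c = refl
  ∑-const (a ∷ L) c = cong (c +_) (∑-const L c)

  length≡∑1 : (L : List A) → length L ≡ ∑[ _ ← L ] 1
  length≡∑1 L = trans (sym (ℕ.*-identityʳ (length L))) (sym (∑-const L 1))

  ∑-length≡0 : (L : List A) (g : A → ℕ) → length L ≡ 0 → ∑ L g ≡ 0
  ∑-length≡0 [] g _ = refl

  ∑-++ : (L M : List A) (g : A → ℕ) → ∑ (L ++ M) g ≡ ∑ L g + ∑ M g
  ∑-++ []      M g = refl
  ∑-++ (a ∷ L) M g rewrite ∑-++ L M g = sym (ℕ.+-assoc (g a) (∑ L g) (∑ M g))

  ∑-map : (h : B → A) (L : List B) (g : A → ℕ) → ∑ (map h L) g ≡ ∑[ b ← L ] g (h b)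
  ∑-map h []      g = refl
  ∑-map h (b ∷ L) g = cong (g (h b) +_) (∑-map h L g)

  ∑-concatMap : (h : B → List A) (L : List B) (g : A → ℕ) →
                ∑ (concatMap h L) g ≡ ∑[ b ← L ] ∑ (h b) g
  ∑-concatMap h []      g = refl
  ∑-concatMap h (b ∷ L) g rewrite ∑-++ (h b) (concatMap h L) g | ∑-concatMap h L g = refl

  ∑-swap : (L : List A) (M : List B) (F : A → B → ℕ) →
           ∑[ a ← L ] ∑[ b ← M ] F a b ≡ ∑[ b ← M ] ∑[ a ← L ] F a b
  ∑-swap []      M F = sym (∑-zero M (λ _ → refl))
  ∑-swap (a ∷ L) M F rewrite ∑-swap L M F = sym (∑-+ M (F a) (λ b → ∑[ a ← L ] F a b))

  ∑-All-cong : {P : A → Set} (L : List A) {g h : A → ℕ} →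
               All P L → (∀ a → P a → g a ≡ h a) → ∑ L g ≡ ∑ L h
  ∑-All-cong []      []         g≗h = refl
  ∑-All-cong (a ∷ L) (pa ∷ pL) g≗h = cong₂ _+_ (g≗h a pa) (∑-All-cong L pL g≗h)

  module _ {P : A → Set} (P? : Decidable P) where

    length-filter : (L : List A) → length (filter P? L) ≡ ∑[ a ← L ] 𝟙 (P? a)
    length-filter []      = refl
    length-filter (a ∷ L) with P? a
    ... | yes _ = cong suc (length-filter L)
    ... | no  _ = length-filter L

    ∑-filter : (L : List A) (g : A → ℕ) → ∑ (filter P? L) g ≡ ∑[ a ← L ] (𝟙 (P? a) * g a)
    ∑-filter []      g = refl
    ∑-filter (a ∷ L) g with P? a
    ... | yes _ = cong₂ _+_ (sym (ℕ.+-identityʳ (g a))) (∑-filter L g)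
    ... | no  _ = ∑-filter L g

    ∑-partition : (L : List A) (g : A → ℕ) →
                  ∑ L g ≡ ∑ (filter P? L) g + ∑ (filter (λ a → ¬? (P? a)) L) g
    ∑-partition []      g = refl
    ∑-partition (a ∷ L) g with P? a
    ... | yes _ rewrite ∑-partition L g = sym (ℕ.+-assoc (g a) _ _)
    ... | no  _ rewrite ∑-partition L g = +-leftCommute (g a) (∑ (filter P? L) g) _
      where
      +-leftCommute : ∀ x y z → x + (y + z) ≡ y + (x + z)
      +-leftCommute = solve-∀

    ∑-filter-cong : (L : List A) {g h : A → ℕ} → (∀ a → P a → g a ≡ h a) →
                    ∑ (filter P? L) g ≡ ∑ (filter P? L) h
    ∑-filter-cong []      g≗h = refl
    ∑-filter-cong (a ∷ L) g≗h with P? a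
    ... | yes pa = cong₂ _+_ (g≗h a pa) (∑-filter-cong L g≗h)
    ... | no  _  = ∑-filter-cong L g≗h

    ¬Any⇒∑𝟙≡0 : (L : List A) → ¬ Any P L → ∑[ a ← L ] 𝟙 (P? a) ≡ 0
    ¬Any⇒∑𝟙≡0 []      _    = refl
    ¬Any⇒∑𝟙≡0 (a ∷ L) ¬any with P? a
    ... | yes pa = ⊥-elim (¬any (here pa))
    ... | no  _  = ¬Any⇒∑𝟙≡0 L (¬any ∘ there)

    ∑𝟙≢0⇒Any : (L : List A) → ∑[ a ← L ] 𝟙 (P? a) ≢ 0 → Any P L
    ∑𝟙≢0⇒Any []      ∑≢0 = ⊥-elim (∑≢0 refl)
    ∑𝟙≢0⇒Any (a ∷ L) ∑≢0 with P? a
    ... | yes pa = here pa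
    ... | no  _  = there (∑𝟙≢0⇒Any L ∑≢0)

module Enumerations where
  open FiniteSums
  open import Data.Nat using (ℕ; zero; suc; _+_; _*_; _^_)
  import Data.Nat.Properties as ℕ
  open import Data.Fin using (Fin)
  import Data.Fin.Properties as Fin
  open import Data.List using (List; []; _∷_; map; length; filter; allFin)
  import Data.List.Properties as List
  open import Data.List.Membership.Propositional using (_∈_)
  open import Data.Vec as Vec using (Vec; []; _∷_)
  open import Data.Vec.Properties using (≡-dec; ∷-injective)
  open import Data.Empty using (⊥-elim)
  open import Data.Product using (proj₁; proj₂)
  open import Function.Base using (id)
  open import Function.Bundles using (_↔_; _⇔_; Inverse; mk⇔)
  open import Relation.Binary.Definitions using (DecidableEquality)
  open import Relation.Binary.PropositionalEquality
  open import Relation.Nullary using (Dec; yes; no)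

  private variable
    A B : Set

  module _ (_≟_ : DecidableEquality A) where

    record IsEnumeration (L : List A) : Set where
      constructor isEnumeration
      field occurs-once : ∀ a → ∑[ b ← L ] 𝟙 (b ≟ a) ≡ 1

    module _ {L : List A} (enum : IsEnumeration L) where
      open IsEnumeration enum

      ∑-sift : (a : A) (g : A → ℕ) → ∑[ b ← L ] (𝟙 (b ≟ a) * g b) ≡ g a
      ∑-sift a g = begin
        ∑[ b ← L ] (𝟙 (b ≟ a) * g b)  ≡⟨ ∑-cong L sift ⟩
        ∑[ b ← L ] (𝟙 (b ≟ a) * g a)  ≡⟨ ∑-*ʳ L (g a) _ ⟩
        ∑[ b ← L ] 𝟙 (b ≟ a) * g a    ≡⟨ cong (_* g a) (occurs-once a) ⟩
        1 * g a                         ≡⟨ ℕ.*-identityˡ (g a) ⟩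
        g a                             ∎
        where
        open ≡-Reasoning
        sift : ∀ b → 𝟙 (b ≟ a) * g b ≡ 𝟙 (b ≟ a) * g a
        sift b with b ≟ a
        ... | yes refl = refl
        ... | no  _    = refl

      ∑-reindex : (σ τ : A → A) → (∀ a → τ (σ a) ≡ a) → (∀ b → σ (τ b) ≡ b) →
                  (g : A → ℕ) → ∑[ a ← L ] g (σ a) ≡ ∑ L g
      ∑-reindex σ τ τσ στ g = begin
        ∑[ a ← L ] g (σ a)                              ≡⟨ ∑-cong L (λ a → sym (∑-sift (σ a) g)) ⟩
        ∑[ a ← L ] ∑[ b ← L ] (𝟙 (b ≟ σ a) * g b)      ≡⟨ ∑-swap L L _ ⟩
        ∑[ b ← L ] ∑[ a ← L ] (𝟙 (b ≟ σ a) * g b)      ≡⟨ ∑-cong L (λ b → ∑-*ʳ L (g b) _) ⟩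
        ∑[ b ← L ] (∑[ a ← L ] 𝟙 (b ≟ σ a) * g b)      ≡⟨ ∑-cong L (λ b → cong (_* g b) (preimage b)) ⟩
        ∑[ b ← L ] (1 * g b)                            ≡⟨ ∑-cong L (λ b → ℕ.*-identityˡ (g b)) ⟩
        ∑ L g                                           ∎
        where
        open ≡-Reasoning
        preimage : ∀ b → ∑[ a ← L ] 𝟙 (b ≟ σ a) ≡ 1
        preimage b = trans (∑-cong L (λ a → 𝟙-cong (mk⇔ (λ b≡σa → trans (sym (τσ a)) (cong τ (sym b≡σa)))
                                                          (λ a≡τb → trans (sym (στ b)) (cong σ (sym a≡τb))))
                                                     (b ≟ σ a) (a ≟ τ b)))
                           (occurs-once (τ b))

      enumeration-complete : ∀ a → a ∈ L
      enumeration-complete a = ∑𝟙≢0⇒Any (a ≟_) L λ ∑≡0 → 0≢1 (trans (sym ∑≡0) once)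
        where
        0≢1 : 0 ≢ 1
        0≢1 ()
        once : ∑[ b ← L ] 𝟙 (a ≟ b) ≡ 1
        once = trans (∑-cong L (λ b → 𝟙-sym (a ≟ b) (b ≟ a))) (occurs-once a)

  allFin-isEnumeration : ∀ n → IsEnumeration Fin._≟_ (allFin n)
  allFin-isEnumeration n = isEnumeration (occurs-once n)
    where
    occurs-once : ∀ n (a : Fin n) → ∑[ j ← allFin n ] 𝟙 (j Fin.≟ a) ≡ 1
    occurs-once (suc n) a = begin
      ∑[ j ← allFin (suc n) ] 𝟙 (j Fin.≟ a)
        ≡⟨ cong (λ L → 𝟙 (Fin.zero Fin.≟ a) + ∑[ j ← L ] 𝟙 (j Fin.≟ a)) (List.map-tabulate id Fin.suc) ⟨
      𝟙 (Fin.zero Fin.≟ a) + ∑[ j ← map Fin.suc (allFin n) ] 𝟙 (j Fin.≟ a)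
        ≡⟨ cong (𝟙 (Fin.zero Fin.≟ a) +_) (∑-map Fin.suc (allFin n) _) ⟩
      𝟙 (Fin.zero Fin.≟ a) + ∑[ j ← allFin n ] 𝟙 (Fin.suc j Fin.≟ a)
        ≡⟨ shifted a ⟩
      1 ∎
      where
      open ≡-Reasoning
      shifted : ∀ a → 𝟙 (Fin.zero Fin.≟ a) + ∑[ j ← allFin n ] 𝟙 (Fin.suc j Fin.≟ a) ≡ 1
      shifted Fin.zero    = cong suc (∑-zero (allFin n) (λ _ → refl))
      shifted (Fin.suc i) =
        trans (∑-cong (allFin n) (λ j → 𝟙-cong (mk⇔ Fin.suc-injective (cong Fin.suc)) _ (j Fin.≟ i)))
              (occurs-once n i)

  map-isEnumeration : (_≟ᴬ_ : DecidableEquality A) (_≟ᴮ_ : DecidableEquality B) (e : A ↔ B) {L : List A} →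
                      IsEnumeration _≟ᴬ_ L → IsEnumeration _≟ᴮ_ (map (Inverse.to e) L)
  map-isEnumeration _≟ᴬ_ _≟ᴮ_ e {L} (isEnumeration occurs-once) = isEnumeration λ b → begin
    ∑[ c ← map to L ] 𝟙 (c ≟ᴮ b)   ≡⟨ ∑-map to L _ ⟩
    ∑[ a ← L ] 𝟙 (to a ≟ᴮ b)       ≡⟨ ∑-cong L (λ a → 𝟙-cong (transpose a b) (to a ≟ᴮ b) (a ≟ᴬ from b)) ⟩
    ∑[ a ← L ] 𝟙 (a ≟ᴬ from b)     ≡⟨ occurs-once (from b) ⟩
    1                               ∎
    where
    open ≡-Reasoning
    open Inverse e
    transpose : ∀ a b → (to a ≡ b) ⇔ (a ≡ from b)
    transpose a b = mk⇔ (λ to-a≡b → trans (sym (strictlyInverseʳ a)) (cong from to-a≡b))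
                      (λ a≡from-b → trans (cong to a≡from-b) (strictlyInverseˡ b))

  𝟙-∷ : {n : ℕ} {a b : A} {as bs : Vec A n} (p : Dec (a ∷ as ≡ b ∷ bs)) (q : Dec (a ≡ b)) (r : Dec (as ≡ bs)) →
        𝟙 p ≡ 𝟙 q * 𝟙 r
  𝟙-∷ (yes _)     (yes _)    (yes _)    = refl
  𝟙-∷ (yes a∷as≡) (no a≢b)   _          = ⊥-elim (a≢b (proj₁ (∷-injective a∷as≡)))
  𝟙-∷ (yes a∷as≡) (yes _)    (no as≢bs) = ⊥-elim (as≢bs (proj₂ (∷-injective a∷as≡)))
  𝟙-∷ (no ≢)      (yes refl) (yes refl) = ⊥-elim (≢ refl)
  𝟙-∷ (no _)      (yes _)    (no _)     = refl
  𝟙-∷ (no _)      (no _)     _          = refl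

  ∑-allVecs : (L : List A) (k : ℕ) (g : Vec A (suc k) → ℕ) →
              ∑ (allVecs L (suc k)) g ≡ ∑[ a ← L ] ∑[ as ← allVecs L k ] g (a ∷ as)
  ∑-allVecs L k g = trans (∑-concatMap (λ a → map (a ∷_) (allVecs L k)) L g)
                          (∑-cong L (λ a → ∑-map (a ∷_) (allVecs L k) g))

  allVecs-isEnumeration : (_≟_ : DecidableEquality A) {L : List A} → IsEnumeration _≟_ L →
                          ∀ k → IsEnumeration (≡-dec _≟_) (allVecs L k)
  allVecs-isEnumeration _≟_ {L} (isEnumeration occurs-once) k = isEnumeration (occurs-once-allVecs k)
    where
    _≟ⱽ_ : ∀ {n} → DecidableEquality (Vec _ n)
    _≟ⱽ_ = ≡-dec _≟_
    occurs-once-allVecs : ∀ k (bs : Vec _ k) → ∑[ as ← allVecs L k ] 𝟙 (as ≟ⱽ bs) ≡ 1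
    occurs-once-allVecs zero    []       = refl
    occurs-once-allVecs (suc k) (b ∷ bs) = begin
      ∑[ v ← allVecs L (suc k) ] 𝟙 (v ≟ⱽ (b ∷ bs))
        ≡⟨ ∑-allVecs L k _ ⟩
      ∑[ a ← L ] ∑[ as ← Lᵏ ] 𝟙 ((a ∷ as) ≟ⱽ (b ∷ bs))
        ≡⟨ ∑-cong L (λ a → ∑-cong Lᵏ (λ as → 𝟙-∷ ((a ∷ as) ≟ⱽ (b ∷ bs)) (a ≟ b) (as ≟ⱽ bs))) ⟩
      ∑[ a ← L ] ∑[ as ← Lᵏ ] (𝟙 (a ≟ b) * 𝟙 (as ≟ⱽ bs))
        ≡⟨ ∑-cong L (λ a → ∑-*ˡ Lᵏ (𝟙 (a ≟ b)) _) ⟩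
      ∑[ a ← L ] (𝟙 (a ≟ b) * ∑[ as ← Lᵏ ] 𝟙 (as ≟ⱽ bs))
        ≡⟨ ∑-cong L (λ a → cong (𝟙 (a ≟ b) *_) (occurs-once-allVecs k bs)) ⟩
      ∑[ a ← L ] (𝟙 (a ≟ b) * 1)
        ≡⟨ ∑-cong L (λ a → ℕ.*-identityʳ _) ⟩
      ∑[ a ← L ] 𝟙 (a ≟ b)
        ≡⟨ occurs-once b ⟩
      1 ∎
      where
      open ≡-Reasoning
      Lᵏ = allVecs L k

  length-allVecs : (L : List A) (k : ℕ) → length (allVecs L k) ≡ length L ^ k
  length-allVecs L zero    = refl
  length-allVecs L (suc k) = begin
    length (allVecs L (suc k))                  ≡⟨ length≡∑1 (allVecs L (suc k)) ⟩
    ∑[ _ ← allVecs L (suc k) ] 1                ≡⟨ ∑-allVecs L k _ ⟩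
    ∑[ a ← L ] ∑[ _ ← allVecs L k ] 1           ≡⟨ ∑-cong L (λ _ → sym (length≡∑1 (allVecs L k))) ⟩
    ∑[ _ ← L ] length (allVecs L k)             ≡⟨ ∑-const L _ ⟩
    length L * length (allVecs L k)             ≡⟨ cong (length L *_) (length-allVecs L k) ⟩
    length L * length L ^ k                     ∎
    where open ≡-Reasoning

  length-agreements^ : (_≟_ : DecidableEquality B) (L : List A) (f φ : A → B) (k : ℕ) →
                       length (filter (λ x → f x ≟ φ x) L) ^ k
                         ≡ ∑[ xs ← allVecs L k ] 𝟙 (≡-dec _≟_ (Vec.map φ xs) (Vec.map f xs))
  length-agreements^ _≟_ L f φ zero    = refl
  length-agreements^ _≟_ L f φ (suc k) = begin
    length (filter agree? L) * length (filter agree? L) ^ k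
      ≡⟨ cong₂ _*_ (length-filter agree? L) (length-agreements^ _≟_ L f φ k) ⟩
    ∑[ a ← L ] 𝟙 (agree? a) * ∑[ as ← allVecs L k ] 𝟙 (φ⃗ as ≟ⱽ f⃗ as)
      ≡⟨ sym (∑-*ʳ L _ _) ⟩
    ∑[ a ← L ] (𝟙 (agree? a) * ∑[ as ← allVecs L k ] 𝟙 (φ⃗ as ≟ⱽ f⃗ as))
      ≡⟨ ∑-cong L (λ a → sym (∑-*ˡ (allVecs L k) (𝟙 (agree? a)) _)) ⟩
    ∑[ a ← L ] ∑[ as ← allVecs L k ] (𝟙 (agree? a) * 𝟙 (φ⃗ as ≟ⱽ f⃗ as))
      ≡⟨ ∑-cong L (λ a → ∑-cong (allVecs L k) (λ as → sym (trans
           (𝟙-∷ (φ⃗ (a ∷ as) ≟ⱽ f⃗ (a ∷ as)) (φ a ≟ f a) (φ⃗ as ≟ⱽ f⃗ as))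
           (cong (_* 𝟙 (φ⃗ as ≟ⱽ f⃗ as)) (𝟙-sym (φ a ≟ f a) (agree? a)))))) ⟩
    ∑[ a ← L ] ∑[ as ← allVecs L k ] 𝟙 (φ⃗ (a ∷ as) ≟ⱽ f⃗ (a ∷ as))
      ≡⟨ sym (∑-allVecs L k _) ⟩
    ∑[ xs ← allVecs L (suc k) ] 𝟙 (φ⃗ xs ≟ⱽ f⃗ xs)
      ∎
    where
    open ≡-Reasoning
    agree? = λ x → f x ≟ φ x
    φ⃗ f⃗ : ∀ {n} → Vec _ n → Vec _ n
    φ⃗ = Vec.map φ
    f⃗ = Vec.map f
    _≟ⱽ_ : ∀ {n} → DecidableEquality (Vec _ n)
    _≟ⱽ_ = ≡-dec _≟_

module Fractions where
  import Algebra.Properties.Group as GroupProperties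
  open FiniteSums using (∑)
  open import Data.Nat as ℕ using (ℕ; zero; suc; NonZero)
  import Data.Nat.Properties as ℕ
  open import Data.Nat.Tactic.RingSolver using (solve-∀)
  open import Data.Integer as ℤ using (+_)
  import Data.Integer.Properties as ℤ
  open import Data.Rational as ℚ using (0ℚ; 1ℚ; toℚᵘ)
  import Data.Rational.Properties as ℚ
  open import Data.Rational.Unnormalised as ℚᵘ using (mkℚᵘ; *≡*; _≃_)
  import Data.Rational.Unnormalised.Properties as ℚᵘ
  open import Data.List using (List; []; _∷_; map)
  open import Relation.Binary.PropositionalEquality

  toℚᵘ-/ₙ : ∀ a b → toℚᵘ (a /ₙ suc b) ≃ mkℚᵘ (+ a) b
  toℚᵘ-/ₙ a b = ℚ.toℚᵘ-fromℚᵘ (mkℚᵘ (+ a) b)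

  /ₙ-cross : ∀ a b c d .{{_ : NonZero b}} .{{_ : NonZero d}} → a ℕ.* d ≡ c ℕ.* b → a /ₙ b ≡ c /ₙ d
  /ₙ-cross a (suc b) c (suc d) ad≡cb = ℚ.toℚᵘ-injective (begin
    toℚᵘ (a /ₙ suc b)   ≈⟨ toℚᵘ-/ₙ a b ⟩
    mkℚᵘ (+ a) b        ≈⟨ *≡* (trans (sym (ℤ.pos-* a (suc d))) (trans (cong +_ ad≡cb) (ℤ.pos-* c (suc b)))) ⟩
    mkℚᵘ (+ c) d        ≈⟨ toℚᵘ-/ₙ c d ⟨
    toℚᵘ (c /ₙ suc d)   ∎)
    where open ℚᵘ.≃-Reasoning

  /ₙ-* : ∀ a b c d .{{_ : NonZero b}} .{{_ : NonZero d}} → (a /ₙ b) ℚ.* (c /ₙ d) ≡ (a ℕ.* c) /ₙ (b ℕ.* d)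
  /ₙ-* a (suc b) c (suc d) = ℚ.toℚᵘ-injective (begin
    toℚᵘ ((a /ₙ suc b) ℚ.* (c /ₙ suc d))         ≈⟨ ℚ.toℚᵘ-homo-* (a /ₙ suc b) (c /ₙ suc d) ⟩
    toℚᵘ (a /ₙ suc b) ℚᵘ.* toℚᵘ (c /ₙ suc d)     ≈⟨ ℚᵘ.*-cong (toℚᵘ-/ₙ a b) (toℚᵘ-/ₙ c d) ⟩
    mkℚᵘ (+ a ℤ.* + c) (d ℕ.+ b ℕ.* suc d)      ≡⟨ cong (λ n → mkℚᵘ n _) (ℤ.pos-* a c) ⟨
    mkℚᵘ (+ (a ℕ.* c)) (d ℕ.+ b ℕ.* suc d)      ≈⟨ toℚᵘ-/ₙ (a ℕ.* c) _ ⟨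
    toℚᵘ ((a ℕ.* c) /ₙ (suc b ℕ.* suc d))       ∎)
    where open ℚᵘ.≃-Reasoning

  /ₙ-+ : ∀ a b c d .{{_ : NonZero b}} .{{_ : NonZero d}} →
         (a /ₙ b) ℚ.+ (c /ₙ d) ≡ (a ℕ.* d ℕ.+ c ℕ.* b) /ₙ (b ℕ.* d)
  /ₙ-+ a (suc b) c (suc d) = ℚ.toℚᵘ-injective (begin
    toℚᵘ ((a /ₙ suc b) ℚ.+ (c /ₙ suc d))
      ≈⟨ ℚ.toℚᵘ-homo-+ (a /ₙ suc b) (c /ₙ suc d) ⟩
    toℚᵘ (a /ₙ suc b) ℚᵘ.+ toℚᵘ (c /ₙ suc d)
      ≈⟨ ℚᵘ.+-cong (toℚᵘ-/ₙ a b) (toℚᵘ-/ₙ c d) ⟩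
    mkℚᵘ (+ a ℤ.* + suc d ℤ.+ + c ℤ.* + suc b) (d ℕ.+ b ℕ.* suc d)
      ≡⟨ cong (λ n → mkℚᵘ n _) numerator ⟩
    mkℚᵘ (+ (a ℕ.* suc d ℕ.+ c ℕ.* suc b)) (d ℕ.+ b ℕ.* suc d)
      ≈⟨ toℚᵘ-/ₙ (a ℕ.* suc d ℕ.+ c ℕ.* suc b) _ ⟨
    toℚᵘ ((a ℕ.* suc d ℕ.+ c ℕ.* suc b) /ₙ (suc b ℕ.* suc d)) ∎)
    where
    open ℚᵘ.≃-Reasoning
    numerator : + a ℤ.* + suc d ℤ.+ + c ℤ.* + suc b ≡ + (a ℕ.* suc d ℕ.+ c ℕ.* suc b)
    numerator = trans (cong₂ ℤ._+_ (sym (ℤ.pos-* a (suc d))) (sym (ℤ.pos-* c (suc b))))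
                      (sym (ℤ.pos-+ (a ℕ.* suc d) (c ℕ.* suc b)))

  0/ₙ : ∀ b .{{_ : NonZero b}} → 0 /ₙ b ≡ 0ℚ
  0/ₙ b = /ₙ-cross 0 b 0 1 refl

  /ₙ-^ : ∀ a b k .{{_ : NonZero b}} → (a /ₙ b) ^ℚ k ≡ (a ℕ.^ k) /ₙ (b ℕ.^ k)
  /ₙ-^ a b zero    = refl
  /ₙ-^ a b (suc k) = trans (cong ((a /ₙ b) ℚ.*_) (/ₙ-^ a b k)) (/ₙ-* a b _ _)
    where instance _ = ℕ.m^n≢0 b k

  sumℚ-/ₙ : {A : Set} (b : ℕ) .{{_ : NonZero b}} (L : List A) (g : A → ℕ) →
            sumℚ (map (λ x → g x /ₙ b) L) ≡ ∑ L g /ₙ b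
  sumℚ-/ₙ b []      g = sym (0/ₙ b)
  sumℚ-/ₙ b (x ∷ L) g = begin
    (g x /ₙ b) ℚ.+ sumℚ (map (λ x → g x /ₙ b) L)     ≡⟨ cong ((g x /ₙ b) ℚ.+_) (sumℚ-/ₙ b L g) ⟩
    (g x /ₙ b) ℚ.+ (∑ L g /ₙ b)                       ≡⟨ /ₙ-+ (g x) b (∑ L g) b ⟩
    (g x ℕ.* b ℕ.+ ∑ L g ℕ.* b) /ₙ (b ℕ.* b)          ≡⟨ /ₙ-cross _ (b ℕ.* b) _ b (common (g x) (∑ L g) b) ⟩
    (g x ℕ.+ ∑ L g) /ₙ b                               ∎
    where
    open ≡-Reasoning
    instance _ = ℕ.m*n≢0 b b
    common : ∀ u v w → (u ℕ.* w ℕ.+ v ℕ.* w) ℕ.* w ≡ (u ℕ.+ v) ℕ.* (w ℕ.* w)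
    common = solve-∀

  -- The hypothesis covers c = 0, where a /ₙ c is the junk value 0ℚ.
  /ₙ-*-cancel : ∀ a c N .{{_ : NonZero N}} → (c ≡ 0 → a ≡ 0) → (c /ₙ N) ℚ.* (a /ₙ c) ≡ a /ₙ N
  /ₙ-*-cancel a zero    N c≡0⇒a≡0 rewrite c≡0⇒a≡0 refl = trans (ℚ.*-zeroʳ (0 /ₙ N)) (sym (0/ₙ N))
  /ₙ-*-cancel a (suc c) N _ =
    trans (/ₙ-* (suc c) N a (suc c)) (/ₙ-cross (suc c ℕ.* a) (N ℕ.* suc c) a N (rearrange (suc c) a N))
    where
    instance _ = ℕ.m*n≢0 N (suc c)
    rearrange : ∀ u v w → (u ℕ.* v) ℕ.* w ≡ v ℕ.* (w ℕ.* u)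
    rearrange = solve-∀

  1-/ₙ : ∀ g r N .{{_ : NonZero N}} → g ℕ.+ r ≡ N → 1ℚ ℚ.- (g /ₙ N) ≡ r /ₙ N
  1-/ₙ g r N g+r≡N = begin
    1ℚ ℚ.- (g /ₙ N)                          ≡⟨ cong (ℚ._- (g /ₙ N)) (sym r/N+g/N≡1) ⟩
    ((r /ₙ N) ℚ.+ (g /ₙ N)) ℚ.- (g /ₙ N)     ≡⟨ ℚ+.//-rightDividesʳ (g /ₙ N) (r /ₙ N) ⟩
    r /ₙ N                                   ∎
    where
    open ≡-Reasoning
    module ℚ+ = GroupProperties ℚ.+-0-group
    instance _ = ℕ.m*n≢0 N N
    r/N+g/N≡1 : (r /ₙ N) ℚ.+ (g /ₙ N) ≡ 1ℚ
    r/N+g/N≡1 = trans (/ₙ-+ r N g N) (/ₙ-cross _ _ 1 1 (begin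
      (r ℕ.* N ℕ.+ g ℕ.* N) ℕ.* 1  ≡⟨ collect r g N ⟩
      (g ℕ.+ r) ℕ.* N               ≡⟨ cong (ℕ._* N) g+r≡N ⟩
      N ℕ.* N                       ≡⟨ ℕ.*-identityˡ (N ℕ.* N) ⟨
      1 ℕ.* (N ℕ.* N)               ∎))
      where
      collect : ∀ u v w → (u ℕ.* w ℕ.+ v ℕ.* w) ℕ.* 1 ≡ (v ℕ.+ u) ℕ.* w
      collect = solve-∀

  /ₙ-split : ∀ s t r h N M .{{_ : NonZero N}} .{{_ : NonZero M}} → s ℕ.* M ≡ t ℕ.* M ℕ.+ r ℕ.* h →
             s /ₙ N ≡ (t /ₙ N) ℚ.+ ((r /ₙ N) ℚ.* (h /ₙ M))
  /ₙ-split s t r h N M sM≡tM+rh = sym (begin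
    (t /ₙ N) ℚ.+ ((r /ₙ N) ℚ.* (h /ₙ M))                          ≡⟨ cong ((t /ₙ N) ℚ.+_) (/ₙ-* r N h M) ⟩
    (t /ₙ N) ℚ.+ ((r ℕ.* h) /ₙ (N ℕ.* M))                          ≡⟨ /ₙ-+ t N (r ℕ.* h) (N ℕ.* M) ⟩
    (t ℕ.* (N ℕ.* M) ℕ.+ r ℕ.* h ℕ.* N) /ₙ (N ℕ.* (N ℕ.* M))      ≡⟨ /ₙ-cross _ _ s N cross ⟩
    s /ₙ N                                                          ∎)
    where
    open ≡-Reasoning
    instance
      _ = ℕ.m*n≢0 N M
      _ = ℕ.m*n≢0 N (N ℕ.* M)
    cross : (t ℕ.* (N ℕ.* M) ℕ.+ r ℕ.* h ℕ.* N) ℕ.* N ≡ s ℕ.* (N ℕ.* (N ℕ.* M))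
    cross = begin
      (t ℕ.* (N ℕ.* M) ℕ.+ r ℕ.* h ℕ.* N) ℕ.* N  ≡⟨ expand t M r h N ⟩
      (t ℕ.* M ℕ.+ r ℕ.* h) ℕ.* (N ℕ.* N)        ≡⟨ cong (ℕ._* (N ℕ.* N)) sM≡tM+rh ⟨
      s ℕ.* M ℕ.* (N ℕ.* N)                       ≡⟨ regroup s M N ⟩
      s ℕ.* (N ℕ.* (N ℕ.* M))                     ∎
      where
      expand : ∀ t m r h n → (t ℕ.* (n ℕ.* m) ℕ.+ r ℕ.* h ℕ.* n) ℕ.* n ≡ (t ℕ.* m ℕ.+ r ℕ.* h) ℕ.* (n ℕ.* n)
      expand = solve-∀
      regroup : ∀ s m n → s ℕ.* m ℕ.* (n ℕ.* n) ≡ s ℕ.* (n ℕ.* (n ℕ.* m))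
      regroup = solve-∀

module Elements (A : FinAbGroup) where
  open FiniteSums
  open Enumerations
  open FinAbGroup A
  open import Data.Nat using (NonZero)
  open import Data.Fin using (Fin)
  import Data.Fin.Properties as Fin
  open import Data.List using (allFin; length)
  import Data.List.Properties as List
  open import Function.Base using (id)
  open import Function.Bundles using (Inverse)
  open import Relation.Binary.PropositionalEquality

  elements-isEnumeration : IsEnumeration _≟_ elements
  elements-isEnumeration = map-isEnumeration Fin._≟_ _≟_ enum {allFin size} (allFin-isEnumeration size)

  length-elements : length elements ≡ size
  length-elements = trans (List.length-map (Inverse.to enum) (allFin size)) (List.length-tabulate id)

  size≢0 : NonZero size
  size≢0 = nonEmpty (Inverse.from enum ε)
    where
    nonEmpty : ∀ {n} → Fin n → NonZero n
    nonEmpty Fin.zero    = _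
    nonEmpty (Fin.suc _) = _

module Fibres (G H : FinAbGroup) where
  open FiniteSums
  open Enumerations
  open import Algebra.Bundles using (AbelianGroup)
  import Algebra.Properties.AbelianGroup as AbelianGroupProperties
  import Algebra.Properties.CommutativeSemigroup as CommutativeSemigroupProperties
  open import Data.Nat using (ℕ; _+_; _*_; _^_)
  import Data.Nat.Properties as ℕ
  open import Data.List using (List; map; length; filter)
  open import Data.List.Membership.Propositional using (find)
  open import Data.List.Membership.Propositional.Properties using (∈-filter⁻)
  open import Data.List.Relation.Unary.All as All using (All)
  open import Data.Product using (_,_; proj₁; proj₂)
  open import Data.Vec as Vec using (Vec; []; _∷_; lookup; replicate; tabulate)
  open import Data.Vec.Properties using (≡-dec; ∷-injective; lookup∘tabulate; tabulate∘lookup; tabulate-cong)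
  open import Function.Bundles using (_⇔_; mk⇔; Inverse; Equivalence)
  import Function.Properties.Equivalence as ⇔
  open import Relation.Binary.Definitions using (DecidableEquality)
  open import Relation.Binary.PropositionalEquality
  open import Relation.Nullary using (yes; no; ¬_)
  open import Relation.Nullary.Decidable using (¬?; decidable-stable)

  private
    module G = FinAbGroup G
    module H = FinAbGroup H
    module EG = Elements G
    module EH = Elements H
  open H using (_∙_; ε; _⁻¹)

  H-abelianGroup : AbelianGroup _ _
  H-abelianGroup = record { isAbelianGroup = H.isAbelianGroup }

  open AbelianGroup H-abelianGroup using (identityˡ; commutativeSemigroup)
  open AbelianGroupProperties H-abelianGroup using (∙-cancelʳ; //-rightDividesˡ; //-rightDividesʳ)
  open CommutativeSemigroupProperties commutativeSemigroup using (interchange)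

  _≟ⱽ_ : ∀ {k} → DecidableEquality (Vec H.Carrier k)
  _≟ⱽ_ = ≡-dec H._≟_

  Additive : (G.Carrier → H.Carrier) → Set
  Additive φ = ∀ x y → φ (x G.∙ y) ≡ φ x ∙ φ y

  isHom⇔additive : (φ : G.Carrier → H.Carrier) → IsHom G H φ ⇔ Additive φ
  isHom⇔additive φ = mk⇔ (λ hom x y → All.lookup (All.lookup hom (∈G x)) (∈G y))
                         (λ additive → All.tabulate (λ {x} _ → All.tabulate (λ {y} _ → additive x y)))
    where ∈G = enumeration-complete G._≟_ EG.elements-isEnumeration

  module _ {a b ψ : G.Carrier → H.Carrier} (ψ-additive : Additive ψ) (b≗a∙ψ : ∀ x → b x ≡ a x ∙ ψ x) where

    additive-translate : Additive a ⇔ Additive b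
    additive-translate = mk⇔ to from
      where
      open ≡-Reasoning
      to : Additive a → Additive b
      to a-additive x y = begin
        b (x G.∙ y)                 ≡⟨ b≗a∙ψ (x G.∙ y) ⟩
        a (x G.∙ y) ∙ ψ (x G.∙ y)   ≡⟨ cong₂ _∙_ (a-additive x y) (ψ-additive x y) ⟩
        (a x ∙ a y) ∙ (ψ x ∙ ψ y)   ≡⟨ interchange (a x) (a y) (ψ x) (ψ y) ⟩
        (a x ∙ ψ x) ∙ (a y ∙ ψ y)   ≡⟨ cong₂ _∙_ (b≗a∙ψ x) (b≗a∙ψ y) ⟨
        b x ∙ b y                   ∎
      from : Additive b → Additive a
      from b-additive x y = ∙-cancelʳ (ψ (x G.∙ y)) _ _ (begin
        a (x G.∙ y) ∙ ψ (x G.∙ y)   ≡⟨ b≗a∙ψ (x G.∙ y) ⟨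
        b (x G.∙ y)                 ≡⟨ b-additive x y ⟩
        b x ∙ b y                   ≡⟨ cong₂ _∙_ (b≗a∙ψ x) (b≗a∙ψ y) ⟩
        (a x ∙ ψ x) ∙ (a y ∙ ψ y)   ≡⟨ interchange (a x) (ψ x) (a y) (ψ y) ⟩
        (a x ∙ a y) ∙ (ψ x ∙ ψ y)   ≡⟨ cong ((a x ∙ a y) ∙_) (ψ-additive x y) ⟨
        (a x ∙ a y) ∙ ψ (x G.∙ y)   ∎)

    Γ-translate : ∀ {k} (xs : Vec G.Carrier k) → Γ G H xs a ≡ replicate k ε ⇔ Γ G H xs b ≡ Γ G H xs ψ
    Γ-translate xs = mk⇔ (to xs) (from xs)
      where
      to : ∀ {k} (xs : Vec G.Carrier k) → Γ G H xs a ≡ replicate k ε → Γ G H xs b ≡ Γ G H xs ψ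
      to []       _   = refl
      to (x ∷ xs) a≡ε = cong₂ _∷_
        (trans (b≗a∙ψ x) (trans (cong (_∙ ψ x) (proj₁ (∷-injective a≡ε))) (identityˡ (ψ x))))
        (to xs (proj₂ (∷-injective a≡ε)))
      from : ∀ {k} (xs : Vec G.Carrier k) → Γ G H xs b ≡ Γ G H xs ψ → Γ G H xs a ≡ replicate k ε
      from []       _   = refl
      from (x ∷ xs) b≡ψ = cong₂ _∷_
        (∙-cancelʳ (ψ x) _ _ (trans (sym (b≗a∙ψ x)) (trans (proj₁ (∷-injective b≡ψ)) (sym (identityˡ (ψ x))))))
        (from xs (proj₂ (∷-injective b≡ψ)))

  -- Functions G → H have no decidable equality, so bijections of Hom(G,H) are built on the tables of
  -- values along the enumeration of G, from which Hom G H is enumerated.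
  table : Vec H.Carrier G.size → G.Carrier → H.Carrier
  table v x = lookup v (Inverse.from G.enum x)

  tables : List (Vec H.Carrier G.size)
  tables = allVecs H.elements G.size

  tables-isEnumeration : IsEnumeration _≟ⱽ_ tables
  tables-isEnumeration = allVecs-isEnumeration H._≟_ EH.elements-isEnumeration G.size

  ∑-Hom : (g : (G.Carrier → H.Carrier) → ℕ) →
          ∑ (Hom G H) g ≡ ∑[ v ← tables ] (𝟙 (isHom? G H (table v)) * g (table v))
  ∑-Hom g = trans (∑-filter (isHom? G H) (map table tables) g) (∑-map table tables _)

  translate : (G.Carrier → H.Carrier) → Vec H.Carrier G.size → Vec H.Carrier G.size
  translate c v = tabulate (λ i → lookup v i ∙ c (Inverse.to G.enum i))

  table-translate : (c : G.Carrier → H.Carrier) (v : Vec H.Carrier G.size) (x : G.Carrier) →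
                    table (translate c v) x ≡ table v x ∙ c x
  table-translate c v x = trans (lookup∘tabulate _ (Inverse.from G.enum x))
                                (cong (λ y → table v x ∙ c y) (Inverse.strictlyInverseˡ G.enum x))

  translate-cancel : (c d : G.Carrier → H.Carrier) → (∀ x y → (y ∙ c x) ∙ d x ≡ y) →
                     (v : Vec H.Carrier G.size) → translate d (translate c v) ≡ v
  translate-cancel c d cancel v = trans (tabulate-cong λ i → trans (cong (_∙ d _) (lookup∘tabulate _ i)) (cancel _ _))
                                        (tabulate∘lookup v)

  fibre : ∀ {k} → Vec G.Carrier k → Vec H.Carrier k → ℕ
  fibre xs h = ∑[ φ ← Hom G H ] 𝟙 (Γ G H xs φ ≟ⱽ h)

  isHom-translate : {ψ : G.Carrier → H.Carrier} → Additive ψ → (v : Vec H.Carrier G.size) →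
                    IsHom G H (table v) ⇔ IsHom G H (table (translate ψ v))
  isHom-translate {ψ} ψ-additive v =
    ⇔.trans (isHom⇔additive _) (⇔.trans (additive-translate ψ-additive (table-translate ψ v)) (⇔.sym (isHom⇔additive _)))

  -- Translation by an additive ψ is a bijection of Hom(G,H) carrying ker Γ onto the fibre over Γ ψ.
  fibre-Γ : {ψ : G.Carrier → H.Carrier} → Additive ψ → ∀ {k} (xs : Vec G.Carrier k) →
            fibre xs (Γ G H xs ψ) ≡ fibre xs (replicate k ε)
  fibre-Γ {ψ} ψ-additive {k} xs = begin
    fibre xs (Γ G H xs ψ)                                 ≡⟨ ∑-Hom _ ⟩
    ∑[ v ← tables ] inFibre (Γ G H xs ψ) v                ≡⟨ ∑-reindex _≟ⱽ_ tables-isEnumeration σ τ τσ στ _ ⟨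
    ∑[ v ← tables ] inFibre (Γ G H xs ψ) (translate ψ v)  ≡⟨ ∑-cong tables translated ⟩
    ∑[ v ← tables ] inFibre (replicate k ε) v             ≡⟨ ∑-Hom _ ⟨
    fibre xs (replicate k ε)                              ∎
    where
    open ≡-Reasoning
    inFibre : Vec H.Carrier k → Vec H.Carrier G.size → ℕ
    inFibre h v = 𝟙 (isHom? G H (table v)) * 𝟙 (Γ G H xs (table v) ≟ⱽ h)
    σ τ : Vec H.Carrier G.size → Vec H.Carrier G.size
    σ = translate ψ
    τ = translate (λ x → ψ x ⁻¹)
    τσ : ∀ v → τ (σ v) ≡ v
    τσ = translate-cancel _ _ (λ x → //-rightDividesʳ (ψ x))
    στ : ∀ v → σ (τ v) ≡ v
    στ = translate-cancel _ _ (λ x → //-rightDividesˡ (ψ x))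
    translated : ∀ v → inFibre (Γ G H xs ψ) (σ v) ≡ inFibre (replicate k ε) v
    translated v = sym (cong₂ _*_
      (𝟙-cong (isHom-translate ψ-additive v) (isHom? G H (table v)) (isHom? G H (table (σ v))))
      (𝟙-cong (Γ-translate ψ-additive (table-translate ψ v) xs)
              (Γ G H xs (table v) ≟ⱽ replicate k ε) (Γ G H xs (table (σ v)) ≟ⱽ Γ G H xs ψ)))

  kerSize≡fibre-ε : ∀ {k} (xs : Vec G.Carrier k) → kerSize G H xs ≡ fibre xs (replicate k ε)
  kerSize≡fibre-ε {k} xs = length-filter (λ φ → Γ G H xs φ ≟ⱽ replicate k ε) (Hom G H)

  fibre-image : ∀ {k} (xs : Vec G.Carrier k) (h : Vec H.Carrier k) → InImage G H xs h → fibre xs h ≡ kerSize G H xs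
  fibre-image {k} xs h h∈image with find h∈image
  ... | ψ , ψ∈Hom , Γψ≡h = begin
    fibre xs h                 ≡⟨ cong (fibre xs) Γψ≡h ⟨
    fibre xs (Γ G H xs ψ)      ≡⟨ fibre-Γ ψ-additive xs ⟩
    fibre xs (replicate k ε)   ≡⟨ kerSize≡fibre-ε xs ⟨
    kerSize G H xs             ∎
    where
    open ≡-Reasoning
    ψ-additive : Additive ψ
    ψ-additive = Equivalence.to (isHom⇔additive ψ) (proj₂ (∈-filter⁻ (isHom? G H) {xs = allFunctions G H} ψ∈Hom))

  fibre≡term : (f : G.Carrier → H.Carrier) → ∀ {k} (xs : Vec G.Carrier k) → fibre xs (Vec.map f xs) ≡ term G H f xs
  fibre≡term f xs with inImage? G H xs (Vec.map f xs)
  ... | yes f⃗∈image = fibre-image xs _ f⃗∈image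
  ... | no  f⃗∉image = ¬Any⇒∑𝟙≡0 (λ φ → Γ G H xs φ ≟ⱽ Vec.map f xs) (Hom G H) f⃗∉image

  Hᵏ-isEnumeration : ∀ k → IsEnumeration _≟ⱽ_ (allVecs H.elements k)
  Hᵏ-isEnumeration = allVecs-isEnumeration H._≟_ EH.elements-isEnumeration

  ∑-fibres : ∀ {k} (xs : Vec G.Carrier k) → ∑[ h ← allVecs H.elements k ] fibre xs h ≡ length (Hom G H)
  ∑-fibres {k} xs = begin
    ∑[ h ← Hᵏ ] ∑[ φ ← Hom G H ] 𝟙 (Γ G H xs φ ≟ⱽ h)   ≡⟨ ∑-swap Hᵏ (Hom G H) _ ⟩
    ∑[ φ ← Hom G H ] ∑[ h ← Hᵏ ] 𝟙 (Γ G H xs φ ≟ⱽ h)   ≡⟨ ∑-cong (Hom G H) (λ φ → lies-in-one-fibre (Γ G H xs φ)) ⟩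
    ∑[ φ ← Hom G H ] 1                                 ≡⟨ length≡∑1 (Hom G H) ⟨
    length (Hom G H)                                   ∎
    where
    open ≡-Reasoning
    Hᵏ = allVecs H.elements k
    lies-in-one-fibre : ∀ h′ → ∑[ h ← Hᵏ ] 𝟙 (h′ ≟ⱽ h) ≡ 1
    lies-in-one-fibre h′ = trans (∑-cong Hᵏ (λ h → 𝟙-sym (h′ ≟ⱽ h) (h ≟ⱽ h′)))
                         (IsEnumeration.occurs-once (Hᵏ-isEnumeration k) h′)

  -- When Γ_x is onto, all |H|ᵏ fibres are cosets of ker Γ_x and together they partition Hom(G,H).
  surjective⇒fibre*|H|ᵏ≡|Hom| : ∀ {k} (xs : Vec G.Carrier k) (h : Vec H.Carrier k) → ¬ InGk G H xs →
                     fibre xs h * H.size ^ k ≡ length (Hom G H)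
  surjective⇒fibre*|H|ᵏ≡|Hom| {k} xs h xs∉𝒢 = begin
    fibre xs h * H.size ^ k                  ≡⟨ cong₂ _*_ (fibre-image xs h (surjective h)) (sym length-Hᵏ) ⟩
    kerSize G H xs * length Hᵏ               ≡⟨ ℕ.*-comm (kerSize G H xs) (length Hᵏ) ⟩
    length Hᵏ * kerSize G H xs               ≡⟨ ∑-const Hᵏ (kerSize G H xs) ⟨
    ∑[ _ ← Hᵏ ] kerSize G H xs               ≡⟨ ∑-All-cong Hᵏ (All.tabulate (λ {h} _ → surjective h)) (fibre-image xs) ⟨
    ∑[ h ← Hᵏ ] fibre xs h                   ≡⟨ ∑-fibres xs ⟩
    length (Hom G H)                         ∎
    where
    open ≡-Reasoning
    Hᵏ = allVecs H.elements k
    length-Hᵏ : length Hᵏ ≡ H.size ^ k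
    length-Hᵏ = trans (length-allVecs H.elements k) (cong (_^ k) EH.length-elements)
    surjective : ∀ h → InImage G H xs h
    surjective h = All.lookup (decidable-stable (All.all? (inImage? G H xs) Hᵏ) xs∉𝒢)
                              (enumeration-complete _≟ⱽ_ (Hᵏ-isEnumeration k) h)

  agreements : (f φ : G.Carrier → H.Carrier) → ℕ
  agreements f φ = length (filter (λ x → f x H.≟ φ x) G.elements)

  ∑-agreements^ : (f : G.Carrier → H.Carrier) (k : ℕ) →
                  ∑[ φ ← Hom G H ] (agreements f φ ^ k) ≡ ∑[ xs ← allVecs G.elements k ] fibre xs (Vec.map f xs)
  ∑-agreements^ f k = trans (∑-cong (Hom G H) (λ φ → length-agreements^ H._≟_ G.elements f φ k))
                            (∑-swap (Hom G H) (allVecs G.elements k) _)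

  outside𝒢 : (k : ℕ) → List (Vec G.Carrier k)
  outside𝒢 k = filter (λ xs → ¬? (inGk? G H xs)) (allVecs G.elements k)

  length-𝒢+outside𝒢 : (k : ℕ) → length (𝒢 G H k) + length (outside𝒢 k) ≡ G.size ^ k
  length-𝒢+outside𝒢 k = begin
    length (𝒢 G H k) + length (outside𝒢 k)             ≡⟨ cong₂ _+_ (length≡∑1 (𝒢 G H k)) (length≡∑1 (outside𝒢 k)) ⟩
    ∑[ _ ← 𝒢 G H k ] 1 + ∑[ _ ← outside𝒢 k ] 1         ≡⟨ ∑-partition (inGk? G H) Gᵏ (λ _ → 1) ⟨
    ∑[ _ ← Gᵏ ] 1                                      ≡⟨ length≡∑1 Gᵏ ⟨
    length Gᵏ                                          ≡⟨ length-allVecs G.elements k ⟩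
    length G.elements ^ k                              ≡⟨ cong (_^ k) EG.length-elements ⟩
    G.size ^ k                                         ∎
    where
    open ≡-Reasoning
    Gᵏ = allVecs G.elements k

  ∑-fibres-split : (f : G.Carrier → H.Carrier) (k : ℕ) →
                   ∑[ xs ← allVecs G.elements k ] fibre xs (Vec.map f xs) * H.size ^ k
                     ≡ ∑ (𝒢 G H k) (term G H f) * H.size ^ k + length (outside𝒢 k) * length (Hom G H)
  ∑-fibres-split f k = begin
    ∑ Gᵏ F * M
      ≡⟨ cong (_* M) (∑-partition (inGk? G H) Gᵏ F) ⟩
    (∑ (𝒢 G H k) F + ∑ (outside𝒢 k) F) * M
      ≡⟨ ℕ.*-distribʳ-+ M (∑ (𝒢 G H k) F) (∑ (outside𝒢 k) F) ⟩
    ∑ (𝒢 G H k) F * M + ∑ (outside𝒢 k) F * M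
      ≡⟨ cong₂ _+_ (cong (_* M) (∑-cong (𝒢 G H k) (fibre≡term f))) (sym (∑-*ʳ (outside𝒢 k) M F)) ⟩
    T * M + ∑[ xs ← outside𝒢 k ] (F xs * M)
      ≡⟨ cong (T * M +_) (∑-filter-cong (λ xs → ¬? (inGk? G H xs)) Gᵏ (λ xs → surjective⇒fibre*|H|ᵏ≡|Hom| xs _)) ⟩
    T * M + ∑[ _ ← outside𝒢 k ] length (Hom G H)
      ≡⟨ cong (T * M +_) (∑-const (outside𝒢 k) _) ⟩
    T * M + length (outside𝒢 k) * length (Hom G H) ∎
    where
    open ≡-Reasoning
    T = ∑ (𝒢 G H k) (term G H f)
    Gᵏ = allVecs G.elements k
    M = H.size ^ k
    F : Vec G.Carrier k → ℕ
    F xs = fibre xs (Vec.map f xs)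

open FiniteSums using (∑; ∑-length≡0)
open Fractions
open Fibres

open import Data.Nat using (ℕ; _≤_; _^_)
open import Data.List using (map; length)
open import Data.Rational using (_+_; _*_; _-_; 1ℚ)
open import Relation.Binary.PropositionalEquality using (_≡_; cong; cong₂; sym; module ≡-Reasoning)
import Data.Nat.Properties as ℕ
open import Data.List.Properties using (map-cong)
import Data.Vec as Vec

lemma2p1 : (G H : FinAbGroup) (k : ℕ) → 1 ≤ k
    → (f : FinAbGroup.Carrier G → FinAbGroup.Carrier H)
    → sumℚ (map (λ φ → agr G H f φ ^ℚ k) (Hom G H))
    ≡ (η G H k * expect G H k f)
    + ((1ℚ - η G H k) * (length (Hom G H) /ₙ (FinAbGroup.size H ^ k)))
lemma2p1 G H k _ f = begin
  sumℚ (map (λ φ → agr G H f φ ^ℚ k) (Hom G H))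
    ≡⟨ cong sumℚ (map-cong (λ φ → /ₙ-^ (agreements G H f φ) (size G) k) (Hom G H)) ⟩
  sumℚ (map (λ φ → (agreements G H f φ ^ k) /ₙ N) (Hom G H))
    ≡⟨ sumℚ-/ₙ N (Hom G H) _ ⟩
  (∑[ φ ← Hom G H ] (agreements G H f φ ^ k)) /ₙ N
    ≡⟨ cong (_/ₙ N) (∑-agreements^ G H f k) ⟩
  (∑[ xs ← allVecs (elements G) k ] fibre G H xs (Vec.map f xs)) /ₙ N
    ≡⟨ /ₙ-split _ _ _ _ N M (∑-fibres-split G H f k) ⟩
  (T /ₙ N) + ((length (outside𝒢 G H k) /ₙ N) * (length (Hom G H) /ₙ M))
    ≡⟨ cong₂ (λ p q → p + (q * (length (Hom G H) /ₙ M)))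
             (sym (/ₙ-*-cancel T (length (𝒢 G H k)) N (∑-length≡0 (𝒢 G H k) (term G H f))))
             (sym (1-/ₙ _ _ N (length-𝒢+outside𝒢 G H k))) ⟩
  (η G H k * expect G H k f) + ((1ℚ - η G H k) * (length (Hom G H) /ₙ M)) ∎
  where
  open FinAbGroup using (size; elements)
  open ≡-Reasoning
  N = size G ^ k
  M = size H ^ k
  T = ∑ (𝒢 G H k) (term G H f)
  instance
    _ = Elements.size≢0 G
    _ = Elements.size≢0 H
    _ = ℕ.m^n≢0 (size G) k
    _ = ℕ.m^n≢0 (size H) k
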